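{- Let $M$ be a $\lambda$-term. If there exists $a\in T_r(M)$ such that $a$ is a positive rigid term in $\to_r$-normal form, then $M$ is a $\beta$-normal form.
   Context: Rigid resource terms: $a ::= x\mid \lambda x.a\mid \langle c\rangle\vec d\mid 0$, $\vec d=(d_1,\dots,d_n)$ a finite list of rigid terms. $\to_r$: contextual closure of $\langle\lambda x.a\rangle\vec b\to_r a[\vec b/x]$ (rigid substitution); a $\to_r$-normal term contains no subterm $\langle\lambda x.a\rangle\vec b$. Rigid expansion: $T_r(x)=\{x\}$, $T_r(\lambda x.M)=\{\lambda x.a\mid a\in T_r(M)\}$, $T_r(PQ)=\{\langle c\rangle(d_1,\dots,d_n)\mid c\in T_r(P), n\ge0, d_i\in T_r(Q)\}$. Positive rigid terms: $x$; $\lambda x.a$ with $a$ positive; $\langle c\rangle(d_1,\dots,d_n)$ with $n\ge1$ and $c,d_i$ positive. -}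

module Defs where

open import Data.Nat using (ℕ)
open import Data.List using (List; []; _∷_)
open import Data.List.Relation.Unary.All using (All)

-- λ-terms, de Bruijn indices (variables as natural numbers)
data Term : Set where
  var : ℕ → Term
  lam : Term → Term
  app : Term → Term → Term

-- rigid resource terms: x | λx.a | ⟨c⟩(d₁,…,dₙ) | 0
data RTerm : Set where
  rvar  : ℕ → RTerm
  rlam  : RTerm → RTerm
  rapp  : RTerm → List RTerm → RTerm
  rzero : RTerm

data NotLam : Term → Set where
  var : ∀ {x} → NotLam (var x)
  app : ∀ {P Q} → NotLam (app P Q)

data RNotLam : RTerm → Set where
  rvar  : ∀ {x} → RNotLam (rvar x)
  rapp  : ∀ {c ds} → RNotLam (rapp c ds)
  rzero : RNotLam rzero

data BetaNF : Term → Set where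
  var : ∀ {x} → BetaNF (var x)
  lam : ∀ {M} → BetaNF M → BetaNF (lam M)
  app : ∀ {P Q} → NotLam P → BetaNF P → BetaNF Q → BetaNF (app P Q)

data RigidNF : RTerm → Set where
  rvar  : ∀ {x} → RigidNF (rvar x)
  rlam  : ∀ {a} → RigidNF a → RigidNF (rlam a)
  rapp  : ∀ {c ds} → RNotLam c → RigidNF c → All RigidNF ds → RigidNF (rapp c ds)
  rzero : RigidNF rzero

data _∈Tr_ : RTerm → Term → Set where
  var : ∀ {x} → rvar x ∈Tr var x
  lam : ∀ {a M} → a ∈Tr M → rlam a ∈Tr lam M
  app : ∀ {c ds P Q} → c ∈Tr P → All (λ d → d ∈Tr Q) ds → rapp c ds ∈Tr app P Q

data Positive : RTerm → Set where
  rvar : ∀ {x} → Positive (rvar x)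
  rlam : ∀ {a} → Positive a → Positive (rlam a)
  rapp : ∀ {c d ds} → Positive c → All Positive (d ∷ ds) → Positive (rapp c (d ∷ ds))

-- Two facts are needed:
--   * the expansion preserves heads: if c ∈ T_r(P) and c is not a rigid
--     abstraction, then P is not an abstraction (an abstraction only expands
--     to abstractions);
--   * at an application node PQ, positivity guarantees that the rigid
--     application ⟨c⟩(d₁,…,dₙ) has n ≥ 1, so the witness d₁ ∈ T_r(Q) is
--     available to show that Q is β-normal (for n = 0 nothing about Q could
--     be concluded).
-- Normality of c transfers to P by the induction hypothesis, and the absence
-- of a rigid redex ⟨λx.a⟩b⃗ transfers to the absence of a β-redex via the
-- first fact.
module Submission where

open import Defs
open import Data.Product using (∃; _×_; _,_)
open import Data.List.Relation.Unary.All using (_∷_)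

-- Elements of T_r(λx.M) are all abstractions, so a non-abstraction
-- element of T_r(P) forces P to be a non-abstraction.
notLam-reflect : ∀ {c P} → c ∈Tr P → RNotLam c → NotLam P
notLam-reflect var       _ = var
notLam-reflect (app _ _) _ = app
notLam-reflect (lam _)   ()

positive-normal⇒betaNF : ∀ {a M} → a ∈Tr M → Positive a → RigidNF a → BetaNF M
positive-normal⇒betaNF var _ _ = var
positive-normal⇒betaNF (lam a∈M) (rlam pos) (rlam nf) =
  lam (positive-normal⇒betaNF a∈M pos nf)
positive-normal⇒betaNF (app c∈P (d∈Q ∷ _)) (rapp posc (posd ∷ _)) (rapp c-notLam nfc (nfd ∷ _)) =
  app (notLam-reflect c∈P c-notLam)
      (positive-normal⇒betaNF c∈P posc nfc)
      (positive-normal⇒betaNF d∈Q posd nfd)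

mainTheorem14 : (M : Term) → ∃ (λ a → a ∈Tr M × Positive a × RigidNF a) → BetaNF M
mainTheorem14 M (a , a∈M , pos , nf) = positive-normal⇒betaNF a∈M pos nf
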